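{- Let $K$ be a 1-dimensional subspace of $W$, $u\in K$ nonzero, and $c\in\mathbb{F}_q^*$. Then $P_{u,c}=\bigcup_{L} P_{u,L,c}$, the union taken over all 2-dimensional subspaces $L$ of $W$ containing $K$, is a collection of triples forming a partition of $W\setminus K$.
   Context: Let $q=6t+1$ be a prime power, $n\geq 2$ an integer, and $W=\mathbb{F}_q^n$. For each 2-dimensional subspace $L$ of $W$ a nonzero skew-symmetric bilinear form $f_L:L\times L\to\mathbb{F}_q$ is fixed. Let $g$ be a generator of $\mathbb{F}_q^*$ and $\omega=g^{2t}$. For linearly independent $u,v\in W$ put $T(u,v)=\{u+v,\ \omega u+\omega^2v,\ \omega^2u+\omega v\}$, and $-S=\{ -x:x\in S\}$. For $L\supset K$ 2-dimensional, $u\in K\setminus\{0\}$, $c\in\mathbb{F}_q^*$, define $P_{u,L,c}=\{T(u,v),-T(u,v): v\in L,\ f_L(u,v)=g^mc \text{ for some }0\leq m<t\}$. -}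

module Defs where

open import Level using (0ℓ)
open import Data.Nat as ℕ using (ℕ; zero; suc)
open import Data.Fin using (Fin)
open import Data.Vec using (Vec; zipWith; map; replicate)
open import Data.Product using (Σ; ∃; ∃-syntax; _×_; _,_)
open import Data.Sum using (_⊎_)
open import Relation.Binary.PropositionalEquality using (_≡_; _≢_)
open import Relation.Nullary using (¬_)
open import Algebra.Structures using (IsCommutativeRing)
open import Function.Bundles using (_↔_)

record FiniteField : Set₁ where
  field
    Carrier : Set
    _+_ _*_ : Carrier → Carrier → Carrier
    -_ : Carrier → Carrier
    0# 1# : Carrier
    isCommutativeRing : IsCommutativeRing _≡_ _+_ _*_ -_ 0# 1#
    0≢1 : 0# ≢ 1#
    inverse : ∀ x → x ≢ 0# → ∃[ y ] (x * y ≡ 1#)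
    size : ℕ
    enumeration : Fin size ↔ Carrier
  infixl 6 _+_
  infixl 7 _*_

  _^_ : Carrier → ℕ → Carrier
  x ^ zero = 1#
  x ^ suc k = x * (x ^ k)

module _ (F : FiniteField) where
  open FiniteField F

  IsGenerator : Carrier → Set
  IsGenerator g = g ≢ 0# × (∀ x → x ≢ 0# → ∃[ k ] (x ≡ g ^ k))

  W : ℕ → Set
  W n = Vec Carrier n

  _⊕_ : ∀ {n} → W n → W n → W n
  _⊕_ = zipWith _+_

  _·_ : ∀ {n} → Carrier → W n → W n
  a · x = map (a *_) x

  zeroV : ∀ {n} → W n
  zeroV = replicate _ 0#

  negV : ∀ {n} → W n → W n
  negV = map -_

  LinIndep : ∀ {n} → W n → W n → Set
  LinIndep u v = ∀ α β → (α · u) ⊕ (β · v) ≡ zeroV → α ≡ 0# × β ≡ 0#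

  Is1Subspace : ∀ {n} → (W n → Set) → Set
  Is1Subspace K = ∃[ a ] (a ≢ zeroV × (∀ x → (K x → ∃[ α ] (x ≡ α · a)) × (∃[ α ] (x ≡ α · a) → K x)))

  Is2Subspace : ∀ {n} → (W n → Set) → Set
  Is2Subspace L = ∃[ a ] ∃[ b ] (LinIndep a b ×
    (∀ x → (L x → ∃[ α ] ∃[ β ] (x ≡ (α · a) ⊕ (β · b)))
         × (∃[ α ] ∃[ β ] (x ≡ (α · a) ⊕ (β · b)) → L x)))

  IsNonzeroSkewForm : ∀ {n} → (W n → Set) → (W n → W n → Carrier) → Set
  IsNonzeroSkewForm L f =
      (∀ x y z → L x → L y → L z → f (x ⊕ y) z ≡ f x z + f y z)
    × (∀ x y z → L x → L y → L z → f x (y ⊕ z) ≡ f x y + f x z)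
    × (∀ a x y → L x → L y → f (a · x) y ≡ a * f x y)
    × (∀ a x y → L x → L y → f x (a · y) ≡ a * f x y)
    × (∀ x y → L x → L y → f x y ≡ - f y x)
    × (∃[ x ] ∃[ y ] (L x × L y × f x y ≢ 0#))

  -- a family assigning to every 2-dimensional subspace L a nonzero skew-symmetric
  -- form f L; since subspaces are predicates, f must depend only on the subspace
  -- (i.e. agree on extensionally equal predicates)
  IsFormFamily : ∀ {n} → ((W n → Set) → W n → W n → Carrier) → Set₁
  IsFormFamily {n} f =
      (∀ (L : W n → Set) → Is2Subspace L → IsNonzeroSkewForm L (f L))
    × (∀ (L L' : W n → Set) → Is2Subspace L → (∀ x → (L x → L' x) × (L' x → L x))
         → ∀ x y → L x → L y → f L x y ≡ f L' x y)

  Triple : ℕ → Set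
  Triple n = W n × W n × W n

  T : ∀ {n} → Carrier → W n → W n → Triple n
  T ω u v = (u ⊕ v) , ((ω · u) ⊕ ((ω * ω) · v)) , (((ω * ω) · u) ⊕ (ω · v))

  negT : ∀ {n} → Triple n → Triple n
  negT (a , b , c) = negV a , negV b , negV c

  _∈T_ : ∀ {n} → W n → Triple n → Set
  x ∈T (a , b , c) = x ≡ a ⊎ x ≡ b ⊎ x ≡ c

  InPL : ∀ {n} → (t : ℕ) → (g : Carrier) → ((W n → Set) → W n → W n → Carrier)
       → W n → (W n → Set) → Carrier → Triple n → Set
  InPL t g f u L c S = ∃[ v ] (L v × LinIndep u v
      × (∃[ m ] (m ℕ.< t × f L u v ≡ (g ^ m) * c))
      × (S ≡ T (g ^ (2 ℕ.* t)) u v ⊎ S ≡ negT (T (g ^ (2 ℕ.* t)) u v)))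

  InP : ∀ {n} → (t : ℕ) → (g : Carrier) → ((W n → Set) → W n → W n → Carrier)
      → (W n → Set) → W n → Carrier → Triple n → Set₁
  InP {n} t g f K u c S = ∃[ L ] (Is2Subspace L × (∀ x → K x → L x) × InPL t g f u L c S)

  PartitionsComplement : ∀ {n} → (Triple n → Set₁) → (W n → Set) → Set₁
  PartitionsComplement {n} P K =
      (∀ S → P S → let (a , b , c) = S in
          a ≢ b × b ≢ c × a ≢ c × ¬ K a × ¬ K b × ¬ K c)
    × (∀ x → ¬ K x → ∃[ S ] (P S × x ∈T S))
    × (∀ S S' x → P S → P S' → x ∈T S → x ∈T S' → ∀ y → (y ∈T S → y ∈T S') × (y ∈T S' → y ∈T S))

-- Let ζ = gᵗ, a primitive sixth root of unity. The six points of ±T(u, v) are ζ⁻ʲu + ζʲv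
-- (0 ≤ j < 6), and f_L(u, ζ⁻ʲu + ζʲv) = ζʲ f_L(u, v) since f_L is alternating. Every member
-- through a point x ∉ K lies in the plane L = ⟨u, x⟩, on which f_L(u, x) = g^(m + j t) c for
-- unique m < t and j < 6 because g has order 6t. So x is the j-th point of exactly one member,
-- namely the one with f_L(u, v) = gᵐ c, and v is recovered from x.

module Submission where

open import Level using (0ℓ)
open import Algebra.Bundles using (CommutativeRing; RawRing)
open import Algebra.Solver.Ring.AlmostCommutativeRing
  using (fromCommutativeRing; _-Raw-AlmostCommutative⟶_)
open import Data.Fin as Fin using (Fin)
open import Data.Fin.Patterns using (0F; 1F; 2F; 3F; 4F; 5F)
import Data.Fin.Properties as Finₚ
open import Data.Maybe using (Maybe; just; nothing)
open import Data.Nat as ℕ using (ℕ; zero; suc; _∸_)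
import Data.Nat.Properties as ℕₚ
open import Data.Nat.DivMod
  using (_%_; _/_; m%n<n; m≡m%n+[m/n]*n; [m+kn]%n≡m%n; m<n⇒m%n≡m; m<n*o⇒m/o<n)
open import Data.Nat.Tactic.RingSolver using (solve-∀)
open import Data.Product using (_×_; _,_; proj₁; proj₂; ∃-syntax)
open import Data.Sum using (_⊎_; inj₁; inj₂)
open import Data.Vec using ([]; _∷_; zipWith)
open import Data.Vec.Properties using (∷-injective)
open import Function using (_∘_; id)
open import Function.Bundles using (Inverse; Injection; _↔_)
open import Function.Construct.Symmetry using (↔-sym)
open import Function.Properties.Inverse using (Inverse⇒Injection)
open import Relation.Binary.Definitions using (Decidable; tri<; tri≈; tri>)
open import Relation.Binary.PropositionalEquality as ≡
  using (_≡_; _≢_; refl; sym; trans; cong; cong₂; subst; module ≡-Reasoning)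
open import Relation.Nullary using (¬_; yes; no)
open import Relation.Nullary.Decidable using (via-injection)
open import Relation.Nullary.Negation using (contradiction)
open import Defs

-- A ring solver for any commutative ring. Its coefficients are integers, as differences of
-- naturals, so that they can be compared by computation; the carrier of an abstract field
-- cannot (which rules out Algebra.Solver.Ring.Simple).
module DifferenceCoefficients {c ℓ} (R : CommutativeRing c ℓ) where
  open CommutativeRing R renaming (refl to ≈-refl; sym to ≈-sym; trans to ≈-trans)
  open import Algebra.Properties.Semiring.Mult semiring
    using (×-homo-+; ×1-homo-*) renaming (_×_ to _×ₘ_)
  open import Algebra.Properties.Ring ring using (x[y-z]≈xy-xz; [y-z]x≈yx-zx)
  open import Algebra.Properties.AbelianGroup +-abelianGroup using (⁻¹-∙-comm; ⁻¹-involutive; ε⁻¹≈ε)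
  open import Algebra.Properties.CommutativeSemigroup +-commutativeSemigroup using (interchange)
  open import Relation.Binary.Reasoning.Setoid setoid

  Difference : Set
  Difference = ℕ × ℕ

  ι : ℕ → Carrier
  ι n = n ×ₘ 1#

  ⟦_⟧ : Difference → Carrier
  ⟦ m , n ⟧ = ι m - ι n

  normalise : ℕ → ℕ → Difference
  normalise m n = m ∸ n , n ∸ m

  normalise-correct : ∀ m n → ⟦ normalise m n ⟧ ≈ ⟦ m , n ⟧
  normalise-correct zero    zero    = ≈-refl
  normalise-correct zero    (suc n) = ≈-refl
  normalise-correct (suc m) zero    = ≈-refl
  normalise-correct (suc m) (suc n) = begin
    ⟦ normalise m n ⟧        ≈⟨ normalise-correct m n ⟩
    M - N                    ≈⟨ +-identityˡ _ ⟨
    0# + (M - N)             ≈⟨ +-congʳ (-‿inverseʳ 1#) ⟨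
    (1# - 1#) + (M - N)      ≈⟨ interchange 1# (- 1#) M (- N) ⟩
    (1# + M) + (- 1# + - N)  ≈⟨ +-congˡ (⁻¹-∙-comm 1# N) ⟩
    (1# + M) - (1# + N)      ∎
    where
    M N : Carrier
    M = ι m
    N = ι n

  difference-+ : ∀ p q r s → (p + r) - (q + s) ≈ (p - q) + (r - s)
  difference-+ p q r s = ≈-trans (+-congˡ (≈-sym (⁻¹-∙-comm q s))) (interchange p r (- q) (- s))

  difference-swap : ∀ p q r s → (p + s) - (r + q) ≈ (p - q) - (r - s)
  difference-swap p q r s = begin
    (p + s) - (r + q)        ≈⟨ difference-+ p r s q ⟩
    (p - r) + (s - q)        ≈⟨ +-congˡ (+-comm s (- q)) ⟩
    (p - r) + (- q + s)      ≈⟨ interchange p (- r) (- q) s ⟩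
    (p - q) + (- r + s)      ≈⟨ +-congˡ (+-congˡ (⁻¹-involutive s)) ⟨
    (p - q) + (- r + - - s)  ≈⟨ +-congˡ (⁻¹-∙-comm r (- s)) ⟩
    (p - q) - (r - s)        ∎

  difference-* : ∀ a b c d → (a * c + b * d) - (a * d + b * c) ≈ (a - b) * (c - d)
  difference-* a b c d = begin
    (a * c + b * d) - (a * d + b * c)  ≈⟨ difference-swap (a * c) (b * c) (a * d) (b * d) ⟩
    (a * c - b * c) - (a * d - b * d)  ≈⟨ +-cong ([y-z]x≈yx-zx c a b) (-‿cong ([y-z]x≈yx-zx d a b)) ⟨
    (a - b) * c - (a - b) * d          ≈⟨ x[y-z]≈xy-xz (a - b) c d ⟨
    (a - b) * (c - d)                  ∎

  _+ᵈ_ _*ᵈ_ : Difference → Difference → Difference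
  (a , b) +ᵈ (c , d) = normalise (a ℕ.+ c) (b ℕ.+ d)
  (a , b) *ᵈ (c , d) = normalise (a ℕ.* c ℕ.+ b ℕ.* d) (a ℕ.* d ℕ.+ b ℕ.* c)

  -ᵈ_ : Difference → Difference
  -ᵈ (a , b) = b , a

  coefficients : RawRing _ _
  coefficients = record
    { Carrier = Difference ; _≈_ = _≡_ ; _+_ = _+ᵈ_ ; _*_ = _*ᵈ_ ; -_ = -ᵈ_
    ; 0# = 0 , 0 ; 1# = 1 , 0 }

  +ᵈ-homo : ∀ x y → ⟦ x +ᵈ y ⟧ ≈ ⟦ x ⟧ + ⟦ y ⟧
  +ᵈ-homo (a , b) (c , d) = begin
    ⟦ normalise (a ℕ.+ c) (b ℕ.+ d) ⟧  ≈⟨ normalise-correct (a ℕ.+ c) (b ℕ.+ d) ⟩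
    ι (a ℕ.+ c) - ι (b ℕ.+ d)          ≈⟨ +-cong (×-homo-+ 1# a c) (-‿cong (×-homo-+ 1# b d)) ⟩
    (A + C) - (B + D)                  ≈⟨ difference-+ A B C D ⟩
    (A - B) + (C - D)                  ∎
    where
    A B C D : Carrier
    A = ι a; B = ι b; C = ι c; D = ι d

  *ᵈ-homo : ∀ x y → ⟦ x *ᵈ y ⟧ ≈ ⟦ x ⟧ * ⟦ y ⟧
  *ᵈ-homo (a , b) (c , d) = begin
    ⟦ normalise (a ℕ.* c ℕ.+ b ℕ.* d) (a ℕ.* d ℕ.+ b ℕ.* c) ⟧
      ≈⟨ normalise-correct (a ℕ.* c ℕ.+ b ℕ.* d) (a ℕ.* d ℕ.+ b ℕ.* c) ⟩
    ι (a ℕ.* c ℕ.+ b ℕ.* d) - ι (a ℕ.* d ℕ.+ b ℕ.* c)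
      ≈⟨ +-cong (homo a c b d) (-‿cong (homo a d b c)) ⟩
    (A * C + B * D) - (A * D + B * C)
      ≈⟨ difference-* A B C D ⟩
    (A - B) * (C - D) ∎
    where
    A B C D : Carrier
    A = ι a; B = ι b; C = ι c; D = ι d
    homo : ∀ m n k l → ι (m ℕ.* n ℕ.+ k ℕ.* l) ≈ ι m * ι n + ι k * ι l
    homo m n k l = ≈-trans (×-homo-+ 1# (m ℕ.* n) (k ℕ.* l)) (+-cong (×1-homo-* m n) (×1-homo-* k l))

  -ᵈ-homo : ∀ x → ⟦ -ᵈ x ⟧ ≈ - ⟦ x ⟧
  -ᵈ-homo (a , b) = begin
    B - A            ≈⟨ +-comm B (- A) ⟩
    - A + B          ≈⟨ +-congˡ (⁻¹-involutive B) ⟨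
    - A + - - B      ≈⟨ ⁻¹-∙-comm A (- B) ⟩
    - (A - B)        ∎
    where
    A B : Carrier
    A = ι a; B = ι b

  interpretation : coefficients -Raw-AlmostCommutative⟶ fromCommutativeRing R
  interpretation = record
    { ⟦_⟧    = ⟦_⟧
    ; +-homo = +ᵈ-homo
    ; *-homo = *ᵈ-homo
    ; -‿homo = -ᵈ-homo
    ; 0-homo = ≈-trans (+-congˡ ε⁻¹≈ε) (+-identityʳ 0#)
    ; 1-homo = ≈-trans (+-congˡ ε⁻¹≈ε) (≈-trans (+-identityʳ _) (+-identityʳ 1#))
    }

  equal? : ∀ x y → Maybe (⟦ x ⟧ ≈ ⟦ y ⟧)
  equal? (a , b) (c , d) with a ℕₚ.≟ c | b ℕₚ.≟ d
  ... | yes ≡.refl | yes ≡.refl = just ≈-refl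
  ... | _          | _          = nothing

  open import Algebra.Solver.Ring coefficients (fromCommutativeRing R) interpretation equal? public
    using (solve; _:=_; _:+_; _:-_; _:*_; :-_)

module FieldProperties (F : FiniteField) where
  open FiniteField F
  open ≡-Reasoning

  commutativeRing : CommutativeRing 0ℓ 0ℓ
  commutativeRing = record { isCommutativeRing = isCommutativeRing }

  open CommutativeRing commutativeRing public
    using ( _-_; +-comm; +-identityˡ; +-identityʳ; -‿inverseˡ; -‿inverseʳ
          ; *-assoc; *-comm; *-identityˡ; *-identityʳ; distribʳ; zeroˡ; zeroʳ
          ; +-group; ring )
  open import Algebra.Properties.Group +-group public
    using (⁻¹-involutive; ε⁻¹≈ε; x∙y⁻¹≈ε⇒x≈y; inverseʳ-unique)
  open import Algebra.Properties.Ring ring public using (-1*x≈-x; +-cancelˡ)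

  infix 4 _≟_
  _≟_ : Decidable (_≡_ {A = Carrier})
  _≟_ = via-injection (Inverse⇒Injection (↔-sym enumeration)) Finₚ._≟_

  open DifferenceCoefficients commutativeRing public using (solve; _:=_; _:+_; _:-_; _:*_; :-_)

  size≢1 : size ≢ 1
  size≢1 size≡1 = 0≢1 (Injection.injective (Inverse⇒Injection index) (Fin1-unique _ _))
    where
    index : Carrier ↔ Fin 1
    index = subst (λ k → Carrier ↔ Fin k) size≡1 (↔-sym enumeration)
    Fin1-unique : (i j : Fin 1) → i ≡ j
    Fin1-unique Fin.zero Fin.zero = refl

  inv : (x : Carrier) → x ≢ 0# → Carrier
  inv x x≢0 = proj₁ (inverse x x≢0)

  *-inverseʳ : ∀ x (x≢0 : x ≢ 0#) → x * inv x x≢0 ≡ 1#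
  *-inverseʳ x x≢0 = proj₂ (inverse x x≢0)

  *-inverseˡ : ∀ x (x≢0 : x ≢ 0#) → inv x x≢0 * x ≡ 1#
  *-inverseˡ x x≢0 = trans (*-comm _ x) (*-inverseʳ x x≢0)

  inv-*-cancel : ∀ x (x≢0 : x ≢ 0#) y → inv x x≢0 * (x * y) ≡ y
  inv-*-cancel x x≢0 y = begin
    inv x x≢0 * (x * y) ≡⟨ *-assoc _ x y ⟨
    inv x x≢0 * x * y   ≡⟨ cong (_* y) (*-inverseˡ x x≢0) ⟩
    1# * y              ≡⟨ *-identityˡ y ⟩
    y                   ∎

  *-cancelˡ : ∀ {x y z} → x ≢ 0# → x * y ≡ x * z → y ≡ z
  *-cancelˡ {x} {y} {z} x≢0 xy≡xz = begin
    y                   ≡⟨ inv-*-cancel x x≢0 y ⟨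
    inv x x≢0 * (x * y) ≡⟨ cong (inv x x≢0 *_) xy≡xz ⟩
    inv x x≢0 * (x * z) ≡⟨ inv-*-cancel x x≢0 z ⟩
    z                   ∎

  *-cancelʳ : ∀ {x y z} → z ≢ 0# → x * z ≡ y * z → x ≡ y
  *-cancelʳ {x} {y} {z} z≢0 eq = *-cancelˡ z≢0 (trans (*-comm z x) (trans eq (*-comm y z)))

  x*y≡0⇒y≡0 : ∀ {x y} → x ≢ 0# → x * y ≡ 0# → y ≡ 0#
  x*y≡0⇒y≡0 {x} x≢0 xy≡0 = *-cancelˡ x≢0 (trans xy≡0 (sym (zeroʳ x)))

  *-nonZero : ∀ {x y} → x ≢ 0# → y ≢ 0# → x * y ≢ 0#
  *-nonZero x≢0 y≢0 = y≢0 ∘ x*y≡0⇒y≡0 x≢0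

  inv-nonZero : ∀ x (x≢0 : x ≢ 0#) → inv x x≢0 ≢ 0#
  inv-nonZero x x≢0 x⁻¹≡0 = 0≢1 (begin
    0#             ≡⟨ zeroʳ x ⟨
    x * 0#         ≡⟨ cong (x *_) x⁻¹≡0 ⟨
    x * inv x x≢0  ≡⟨ *-inverseʳ x x≢0 ⟩
    1#             ∎)

  x²≡1⇒x≡-1 : ∀ {x} → x * x ≡ 1# → x ≢ 1# → x ≡ - 1#
  x²≡1⇒x≡-1 {x} x²≡1 x≢1 with x - 1# ≟ 0#
  ... | yes x-1≡0 = contradiction (x∙y⁻¹≈ε⇒x≈y x 1# x-1≡0) x≢1
  ... | no  x-1≢0 = inverseʳ-unique 1# x (trans (+-comm 1# x) (x*y≡0⇒y≡0 x-1≢0 (begin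
    (x - 1#) * (x + 1#)    ≡⟨ solve 2 (λ x o → (x :- o) :* (x :+ o) := x :* x :- o :* o) refl x 1# ⟩
    x * x - 1# * 1#        ≡⟨ cong₂ _-_ x²≡1 (*-identityˡ 1#) ⟩
    1# - 1#                ≡⟨ -‿inverseʳ 1# ⟩
    0#                     ∎)))

  ^-+ : ∀ x a b → x ^ (a ℕ.+ b) ≡ x ^ a * x ^ b
  ^-+ x zero    b = sym (*-identityˡ _)
  ^-+ x (suc a) b = trans (cong (x *_) (^-+ x a b)) (sym (*-assoc x _ _))

  x^d≡1⇒x^[q*d]≡1 : ∀ x d → x ^ d ≡ 1# → ∀ q → x ^ (q ℕ.* d) ≡ 1#
  x^d≡1⇒x^[q*d]≡1 x d xᵈ≡1 zero    = refl
  x^d≡1⇒x^[q*d]≡1 x d xᵈ≡1 (suc q) = begin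
    x ^ (d ℕ.+ q ℕ.* d)     ≡⟨ ^-+ x d (q ℕ.* d) ⟩
    x ^ d * x ^ (q ℕ.* d)   ≡⟨ cong₂ _*_ xᵈ≡1 (x^d≡1⇒x^[q*d]≡1 x d xᵈ≡1 q) ⟩
    1# * 1#                 ≡⟨ *-identityˡ 1# ⟩
    1#                      ∎

module LinearCombinations (F : FiniteField) where
  open FiniteField F
  open FieldProperties F
  open ≡-Reasoning

  private variable n : ℕ

  lin : Carrier → Carrier → W F n → W F n → W F n
  lin a b = zipWith (λ x y → a * x + b * y)

  ⊕-·-lin : ∀ a b (u v : W F n) → _⊕_ F (_·_ F a u) (_·_ F b v) ≡ lin a b u v
  ⊕-·-lin a b []      []      = refl
  ⊕-·-lin a b (x ∷ u) (y ∷ v) = cong (_ ∷_) (⊕-·-lin a b u v)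

  ⊕-lin : ∀ (u v : W F n) → _⊕_ F u v ≡ lin 1# 1# u v
  ⊕-lin []      []      = refl
  ⊕-lin (x ∷ u) (y ∷ v) = cong₂ _∷_ (sym (cong₂ _+_ (*-identityˡ x) (*-identityˡ y))) (⊕-lin u v)

  ·-lin : ∀ a (u v : W F n) → _·_ F a u ≡ lin a 0# u v
  ·-lin a []      []      = refl
  ·-lin a (x ∷ u) (y ∷ v) = cong₂ _∷_ (sym (trans (cong (a * x +_) (zeroˡ y)) (+-identityʳ _))) (·-lin a u v)

  negV-lin : ∀ a b (u v : W F n) → negV F (lin a b u v) ≡ lin (- a) (- b) u v
  negV-lin a b []      []      = refl
  negV-lin a b (x ∷ u) (y ∷ v) = cong₂ _∷_
    (solve 4 (λ a b x y → :- (a :* x :+ b :* y) := :- a :* x :+ :- b :* y) refl a b x y)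
    (negV-lin a b u v)

  lin-0#-0# : ∀ (u v : W F n) → lin 0# 0# u v ≡ zeroV F
  lin-0#-0# []      []      = refl
  lin-0#-0# (x ∷ u) (y ∷ v) =
    cong₂ _∷_ (trans (cong₂ _+_ (zeroˡ x) (zeroˡ y)) (+-identityˡ 0#)) (lin-0#-0# u v)

  lin-0#-1# : ∀ (u v : W F n) → lin 0# 1# u v ≡ v
  lin-0#-1# []      []      = refl
  lin-0#-1# (x ∷ u) (y ∷ v) =
    cong₂ _∷_ (trans (cong₂ _+_ (zeroˡ x) (*-identityˡ y)) (+-identityˡ y)) (lin-0#-1# u v)

  lin-1#-0# : ∀ (u v : W F n) → lin 1# 0# u v ≡ u
  lin-1#-0# []      []      = refl
  lin-1#-0# (x ∷ u) (y ∷ v) =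
    cong₂ _∷_ (trans (cong₂ _+_ (*-identityˡ x) (zeroˡ y)) (+-identityʳ x)) (lin-1#-0# u v)

  lin-lin : ∀ a b c d (u v : W F n) → lin a b u (lin c d u v) ≡ lin (a + b * c) (b * d) u v
  lin-lin a b c d []      []      = refl
  lin-lin a b c d (x ∷ u) (y ∷ v) = cong₂ _∷_
    (solve 6 (λ a b c d x y → a :* x :+ b :* (c :* x :+ d :* y) := (a :+ b :* c) :* x :+ (b :* d) :* y)
           refl a b c d x y)
    (lin-lin a b c d u v)

  lin-lin² : ∀ α β a b c d (u v : W F n)
           → lin α β (lin a b u v) (lin c d u v) ≡ lin (α * a + β * c) (α * b + β * d) u v
  lin-lin² α β a b c d []      []      = refl
  lin-lin² α β a b c d (x ∷ u) (y ∷ v) = cong₂ _∷_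
    (solve 8 (λ α β a b c d x y → α :* (a :* x :+ b :* y) :+ β :* (c :* x :+ d :* y)
                                 := (α :* a :+ β :* c) :* x :+ (α :* b :+ β :* d) :* y)
           refl α β a b c d x y)
    (lin-lin² α β a b c d u v)

  lin-cancelʳ : ∀ a {b} (u : W F n) {v v'} → b ≢ 0# → lin a b u v ≡ lin a b u v' → v ≡ v'
  lin-cancelʳ a []      {[]}    {[]}      b≢0 eq = refl
  lin-cancelʳ a (x ∷ u) {y ∷ v} {y' ∷ v'} b≢0 eq = cong₂ _∷_
    (*-cancelˡ b≢0 (+-cancelˡ (a * x) _ _ (proj₁ (∷-injective eq))))
    (lin-cancelʳ a u b≢0 (proj₂ (∷-injective eq)))

  lin-sub : ∀ a b c d (u v : W F n) → lin a b u v ≡ lin c d u v → lin (a - c) (b - d) u v ≡ zeroV F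
  lin-sub a b c d []      []      eq = refl
  lin-sub a b c d (x ∷ u) (y ∷ v) eq = cong₂ _∷_ head (lin-sub a b c d u v (proj₂ (∷-injective eq)))
    where
    head : (a - c) * x + (b - d) * y ≡ 0#
    head = begin
      (a - c) * x + (b - d) * y            ≡⟨ solve 6 (λ a b c d x y → (a :- c) :* x :+ (b :- d) :* y
                                                   := (a :* x :+ b :* y) :- (c :* x :+ d :* y)) refl a b c d x y ⟩
      (a * x + b * y) - (c * x + d * y)    ≡⟨ cong (_- (c * x + d * y)) (proj₁ (∷-injective eq)) ⟩
      (c * x + d * y) - (c * x + d * y)    ≡⟨ -‿inverseʳ _ ⟩
      0#                                   ∎

  ·-zeroV : ∀ a → _·_ F a (zeroV F {n}) ≡ zeroV F
  ·-zeroV {zero}  a = refl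
  ·-zeroV {suc n} a = cong₂ _∷_ (zeroʳ a) (·-zeroV a)

  ·-· : ∀ a b (u : W F n) → _·_ F a (_·_ F b u) ≡ _·_ F (a * b) u
  ·-· a b []      = refl
  ·-· a b (x ∷ u) = cong₂ _∷_ (sym (*-assoc a b x)) (·-· a b u)

  ·≡zeroV⇒≡zeroV : ∀ {a} (u : W F n) → a ≢ 0# → _·_ F a u ≡ zeroV F → u ≡ zeroV F
  ·≡zeroV⇒≡zeroV []      a≢0 eq = refl
  ·≡zeroV⇒≡zeroV (x ∷ u) a≢0 eq = cong₂ _∷_
    (x*y≡0⇒y≡0 a≢0 (proj₁ (∷-injective eq)))
    (·≡zeroV⇒≡zeroV u a≢0 (proj₂ (∷-injective eq)))

  lin-zeroVʳ : ∀ a b (u : W F n) → lin a b u (zeroV F) ≡ _·_ F a u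
  lin-zeroVʳ a b []      = refl
  lin-zeroVʳ a b (x ∷ u) = cong₂ _∷_ (trans (cong (a * x +_) (zeroʳ b)) (+-identityʳ _)) (lin-zeroVʳ a b u)

  lin-shear-inverseˡ : ∀ a {b} (b≢0 : b ≢ 0#) (u v : W F n)
              → lin (- (inv b b≢0 * a)) (inv b b≢0) u (lin a b u v) ≡ v
  lin-shear-inverseˡ a {b} b≢0 u v = begin
    lin (- (b⁻¹ * a)) b⁻¹ u (lin a b u v)
      ≡⟨ lin-lin _ _ a b u v ⟩
    lin (- (b⁻¹ * a) + b⁻¹ * a) (b⁻¹ * b) u v
      ≡⟨ cong₂ (λ c d → lin c d u v) (-‿inverseˡ _) (*-inverseˡ b b≢0) ⟩
    lin 0# 1# u v
      ≡⟨ lin-0#-1# u v ⟩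
    v ∎
    where
    b⁻¹ : Carrier
    b⁻¹ = inv b b≢0

  lin-shear-inverseʳ : ∀ a {b} (b≢0 : b ≢ 0#) (u v : W F n)
              → lin a b u (lin (- (a * inv b b≢0)) (inv b b≢0) u v) ≡ v
  lin-shear-inverseʳ a {b} b≢0 u v = begin
    lin a b u (lin (- (a * b⁻¹)) b⁻¹ u v)      ≡⟨ lin-lin a b _ _ u v ⟩
    lin (a + b * - (a * b⁻¹)) (b * b⁻¹) u v    ≡⟨ cong₂ (λ c d → lin c d u v) cancel (*-inverseʳ b b≢0) ⟩
    lin 0# 1# u v                              ≡⟨ lin-0#-1# u v ⟩
    v                                          ∎
    where
    b⁻¹ : Carrier
    b⁻¹ = inv b b≢0
    cancel : a + b * - (a * b⁻¹) ≡ 0#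
    cancel = begin
      a + b * - (a * b⁻¹)  ≡⟨ solve 3 (λ a b c → a :+ b :* :- (a :* c) := a :- a :* (b :* c)) refl a b b⁻¹ ⟩
      a - a * (b * b⁻¹)    ≡⟨ cong (λ c → a - a * c) (*-inverseʳ b b≢0) ⟩
      a - a * 1#           ≡⟨ cong (λ c → a - c) (*-identityʳ a) ⟩
      a - a                ≡⟨ -‿inverseʳ a ⟩
      0#                   ∎

  module _ {u v : W F n} (indep : LinIndep F u v) where
    LinIndep-zero : ∀ a b → lin a b u v ≡ zeroV F → a ≡ 0# × b ≡ 0#
    LinIndep-zero a b eq = indep a b (trans (⊕-·-lin a b u v) eq)

    LinIndep-coefficients : ∀ {a b c d} → lin a b u v ≡ lin c d u v → a ≡ c × b ≡ d
    LinIndep-coefficients {a} {b} {c} {d} eq with LinIndep-zero (a - c) (b - d) (lin-sub a b c d u v eq)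
    ... | a-c≡0 , b-d≡0 = x∙y⁻¹≈ε⇒x≈y a c a-c≡0 , x∙y⁻¹≈ε⇒x≈y b d b-d≡0

    LinIndep⇒≢zeroV : u ≢ zeroV F
    LinIndep⇒≢zeroV u≡0 = 0≢1 (sym (proj₁ (LinIndep-zero 1# 0# (begin
      lin 1# 0# u v       ≡⟨ ·-lin 1# u v ⟨
      _·_ F 1# u          ≡⟨ cong (_·_ F 1#) u≡0 ⟩
      _·_ F 1# (zeroV F)  ≡⟨ ·-zeroV 1# ⟩
      zeroV F             ∎))))

    LinIndep-shear : ∀ r {p} → p ≢ 0# → LinIndep F u (lin r p u v)
    LinIndep-shear r {p} p≢0 a b eq = a≡0 , b≡0
      where
      coefficients≡0 : a + b * r ≡ 0# × b * p ≡ 0#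
      coefficients≡0 = LinIndep-zero _ _ (begin
        lin (a + b * r) (b * p) u v     ≡⟨ lin-lin a b r p u v ⟨
        lin a b u (lin r p u v)         ≡⟨ ⊕-·-lin a b u _ ⟨
        _⊕_ F (_·_ F a u) (_·_ F b _)   ≡⟨ eq ⟩
        zeroV F                         ∎)
      b≡0 : b ≡ 0#
      b≡0 = x*y≡0⇒y≡0 p≢0 (trans (*-comm p b) (proj₂ coefficients≡0))
      a≡0 : a ≡ 0#
      a≡0 = begin
        a           ≡⟨ +-identityʳ a ⟨
        a + 0#      ≡⟨ cong (a +_) (zeroˡ r) ⟨
        a + 0# * r  ≡⟨ cong (λ c → a + c * r) b≡0 ⟨
        a + b * r   ≡⟨ proj₁ coefficients≡0 ⟩
        0#          ∎

  nonMultiple⇒LinIndep : ∀ {u v : W F n} → u ≢ zeroV F → (∀ a → v ≢ _·_ F a u) → LinIndep F u v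
  nonMultiple⇒LinIndep {u = u} {v} u≢0 v∉Fu a b eq with b ≟ 0#
  ... | no b≢0 = contradiction (begin
    v                                                    ≡⟨ lin-shear-inverseˡ a b≢0 u v ⟨
    lin (- (inv b b≢0 * a)) (inv b b≢0) u (lin a b u v)  ≡⟨ cong (lin _ _ u) (trans (sym (⊕-·-lin a b u v)) eq) ⟩
    lin (- (inv b b≢0 * a)) (inv b b≢0) u (zeroV F)      ≡⟨ lin-zeroVʳ _ _ u ⟩
    _·_ F (- (inv b b≢0 * a)) u                          ∎) (v∉Fu _)
  ... | yes b≡0 with a ≟ 0#
  ...   | yes a≡0 = a≡0 , b≡0
  ...   | no  a≢0 = contradiction (·≡zeroV⇒≡zeroV u a≢0 (begin
    _·_ F a u                          ≡⟨ ·-lin a u v ⟩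
    lin a 0# u v                       ≡⟨ cong (λ c → lin a c u v) b≡0 ⟨
    lin a b u v                        ≡⟨ ⊕-·-lin a b u v ⟨
    _⊕_ F (_·_ F a u) (_·_ F b v)      ≡⟨ eq ⟩
    zeroV F                            ∎)) u≢0

module Subspaces (F : FiniteField) where
  open FiniteField F
  open FieldProperties F
  open LinearCombinations F
  open ≡-Reasoning

  private variable n : ℕ

  module _ {L : W F n → Set} (L-2 : Is2Subspace F L) where
    private
      a₀ b₀ : W F n
      a₀ = proj₁ L-2
      b₀ = proj₁ (proj₂ L-2)

      coordinates : ∀ {y} → L y → ∃[ α ] ∃[ β ] (y ≡ lin α β a₀ b₀)
      coordinates {y} Ly with proj₁ (proj₂ (proj₂ (proj₂ L-2)) y) Ly
      ... | α , β , y≡ = α , β , trans y≡ (⊕-·-lin α β a₀ b₀)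

      fromCoordinates : ∀ {y} α β → y ≡ lin α β a₀ b₀ → L y
      fromCoordinates {y} α β y≡ =
        proj₂ (proj₂ (proj₂ (proj₂ L-2)) y) (α , β , trans y≡ (sym (⊕-·-lin α β a₀ b₀)))

    lin-closed : ∀ {y z} → L y → L z → ∀ p q → L (lin p q y z)
    lin-closed Ly Lz p q with coordinates Ly | coordinates Lz
    ... | α , β , refl | γ , δ , refl = fromCoordinates _ _ (lin-lin² p q α β γ δ a₀ b₀)

    -- Cramer's rule for the change of basis from (a₀, b₀) to (u, v), of determinant D.
    spanned-by : ∀ {u v} → L u → L v → LinIndep F u v → ∀ {y} → L y → ∃[ p ] ∃[ q ] (y ≡ lin p q u v)
    spanned-by {u} {v} Lu Lv indep {y} Ly with coordinates Lu | coordinates Lv | coordinates Ly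
    ... | α , β , refl | γ , δ , refl | p , q , refl = P , Q , (begin
      lin p q a₀ b₀
        ≡⟨ cong₂ (λ c d → lin c d a₀ b₀) P-coordinate Q-coordinate ⟨
      lin (P * α + Q * γ) (P * β + Q * δ) a₀ b₀
        ≡⟨ lin-lin² P Q α β γ δ a₀ b₀ ⟨
      lin P Q (lin α β a₀ b₀) (lin γ δ a₀ b₀) ∎)
      where
      D : Carrier
      D = α * δ - β * γ

      second-vanishes : ∀ s r → s * α + r * γ ≡ 0# → s * β + r * δ ≡ 0# → r ≡ 0#
      second-vanishes s r first≡0 second≡0 = proj₂ (LinIndep-zero indep s r (begin
        lin s r (lin α β a₀ b₀) (lin γ δ a₀ b₀)    ≡⟨ lin-lin² s r α β γ δ a₀ b₀ ⟩
        lin (s * α + r * γ) (s * β + r * δ) a₀ b₀  ≡⟨ cong₂ (λ a b → lin a b a₀ b₀) first≡0 second≡0 ⟩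
        lin 0# 0# a₀ b₀                            ≡⟨ lin-0#-0# a₀ b₀ ⟩
        zeroV F                                    ∎))

      D≢0 : D ≢ 0#
      D≢0 D≡0 = LinIndep⇒≢zeroV indep (begin
        lin α β a₀ b₀    ≡⟨ cong₂ (λ c d → lin c d a₀ b₀) α≡0 β≡0 ⟩
        lin 0# 0# a₀ b₀  ≡⟨ lin-0#-0# a₀ b₀ ⟩
        zeroV F          ∎)
        where
        α≡0 : α ≡ 0#
        α≡0 = second-vanishes (- γ) α
          (trans (solve 2 (λ α γ → :- γ :* α :+ α :* γ := α :* γ :- α :* γ) refl α γ) (-‿inverseʳ _))
          (trans (solve 4 (λ α β γ δ → :- γ :* β :+ α :* δ := α :* δ :- β :* γ) refl α β γ δ) D≡0)
        β≡0 : β ≡ 0#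
        β≡0 = second-vanishes (- δ) β
          (trans (solve 4 (λ α β γ δ → :- δ :* α :+ β :* γ := :- (α :* δ :- β :* γ)) refl α β γ δ)
                 (trans (cong -_ D≡0) ε⁻¹≈ε))
          (trans (solve 2 (λ β δ → :- δ :* β :+ β :* δ := β :* δ :- β :* δ) refl β δ) (-‿inverseʳ _))

      D⁻¹ P Q : Carrier
      D⁻¹ = inv D D≢0
      P = D⁻¹ * (p * δ - q * γ)
      Q = D⁻¹ * (q * α - p * β)

      P-coordinate : P * α + Q * γ ≡ p
      P-coordinate = begin
        P * α + Q * γ  ≡⟨ solve 7 (λ i p q α β γ δ →
                              i :* (p :* δ :- q :* γ) :* α :+ i :* (q :* α :- p :* β) :* γ
                              := i :* (α :* δ :- β :* γ) :* p) refl D⁻¹ p q α β γ δ ⟩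
        D⁻¹ * D * p    ≡⟨ cong (_* p) (*-inverseˡ D D≢0) ⟩
        1# * p         ≡⟨ *-identityˡ p ⟩
        p              ∎

      Q-coordinate : P * β + Q * δ ≡ q
      Q-coordinate = begin
        P * β + Q * δ  ≡⟨ solve 7 (λ i p q α β γ δ →
                              i :* (p :* δ :- q :* γ) :* β :+ i :* (q :* α :- p :* β) :* δ
                              := i :* (α :* δ :- β :* γ) :* q) refl D⁻¹ p q α β γ δ ⟩
        D⁻¹ * D * q    ≡⟨ cong (_* q) (*-inverseˡ D D≢0) ⟩
        1# * q         ≡⟨ *-identityˡ q ⟩
        q              ∎

  module _ {K : W F n → Set} (K-1 : Is1Subspace F K) {u} (Ku : K u) (u≢0 : u ≢ zeroV F) where
    private
      a₀ : W F n
      a₀ = proj₁ K-1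

      K⇔multiple-of-a₀ : ∀ y → (K y → ∃[ α ] (y ≡ _·_ F α a₀))
                             × (∃[ α ] (y ≡ _·_ F α a₀) → K y)
      K⇔multiple-of-a₀ = proj₂ (proj₂ K-1)

      β : Carrier
      β = proj₁ (proj₁ (K⇔multiple-of-a₀ u) Ku)

      u≡βa₀ : u ≡ _·_ F β a₀
      u≡βa₀ = proj₂ (proj₁ (K⇔multiple-of-a₀ u) Ku)

      β≢0 : β ≢ 0#
      β≢0 β≡0 = u≢0 (begin
        u                 ≡⟨ u≡βa₀ ⟩
        _·_ F β a₀        ≡⟨ cong (λ b → _·_ F b a₀) β≡0 ⟩
        _·_ F 0# a₀       ≡⟨ ·-lin 0# a₀ a₀ ⟩
        lin 0# 0# a₀ a₀   ≡⟨ lin-0#-0# a₀ a₀ ⟩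
        zeroV F           ∎)

    Is1Subspace⇒multiple : ∀ {y} → K y → ∃[ a ] (y ≡ _·_ F a u)
    Is1Subspace⇒multiple {y} Ky with proj₁ (K⇔multiple-of-a₀ y) Ky
    ... | α , y≡αa₀ = α * inv β β≢0 , (begin
      y                                   ≡⟨ y≡αa₀ ⟩
      _·_ F α a₀                          ≡⟨ cong (λ b → _·_ F b a₀) α≡αβ⁻¹β ⟩
      _·_ F (α * inv β β≢0 * β) a₀        ≡⟨ ·-· _ β a₀ ⟨
      _·_ F (α * inv β β≢0) (_·_ F β a₀)  ≡⟨ cong (_·_ F _) u≡βa₀ ⟨
      _·_ F (α * inv β β≢0) u             ∎)
      where
      α≡αβ⁻¹β : α ≡ α * inv β β≢0 * β
      α≡αβ⁻¹β = sym (trans (*-assoc α _ β) (trans (cong (α *_) (*-inverseˡ β β≢0)) (*-identityʳ α)))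

    Is1Subspace-∋-multiple : ∀ a → K (_·_ F a u)
    Is1Subspace-∋-multiple a =
      proj₂ (K⇔multiple-of-a₀ _) (a * β , trans (cong (_·_ F a) u≡βa₀) (·-· a β a₀))

  Span : W F n → W F n → W F n → Set
  Span u v y = ∃[ α ] ∃[ β ] (y ≡ _⊕_ F (_·_ F α u) (_·_ F β v))

  Span-is2Subspace : ∀ {u v : W F n} → LinIndep F u v → Is2Subspace F (Span u v)
  Span-is2Subspace {u = u} {v} indep = u , v , indep , λ y → id , id

  Span∋ˡ : ∀ {u v : W F n} → Span u v u
  Span∋ˡ {u = u} {v} = 1# , 0# , sym (trans (⊕-·-lin 1# 0# u v) (lin-1#-0# u v))

  Span∋ʳ : ∀ {u v : W F n} → Span u v v
  Span∋ʳ {u = u} {v} = 0# , 1# , sym (trans (⊕-·-lin 0# 1# u v) (lin-0#-1# u v))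

  Is2Subspace-⊆ : ∀ {L L' : W F n → Set} → Is2Subspace F L → Is2Subspace F L'
                → ∀ {u v} → L u → L v → L' u → L' v → LinIndep F u v → ∀ {y} → L y → L' y
  Is2Subspace-⊆ L-2 L'-2 Lu Lv L'u L'v indep Ly with spanned-by L-2 Lu Lv indep Ly
  ... | p , q , refl = lin-closed L'-2 L'u L'v p q

module SkewForms (F : FiniteField) where
  open FiniteField F
  open FieldProperties F
  open LinearCombinations F
  open Subspaces F
  open ≡-Reasoning

  module _ {n} {L : W F n → Set} (L-2 : Is2Subspace F L)
           {f : W F n → W F n → Carrier} (f-skew : IsNonzeroSkewForm F L f)
           (2≢0 : 1# + 1# ≢ 0#) where
    private
      f-+ˡ : ∀ x y z → L x → L y → L z → f (_⊕_ F x y) z ≡ f x z + f y z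
      f-+ˡ = proj₁ f-skew

      f-+ʳ : ∀ x y z → L x → L y → L z → f x (_⊕_ F y z) ≡ f x y + f x z
      f-+ʳ = proj₁ (proj₂ f-skew)

      f-·ˡ : ∀ a x y → L x → L y → f (_·_ F a x) y ≡ a * f x y
      f-·ˡ = proj₁ (proj₂ (proj₂ f-skew))

      f-·ʳ : ∀ a x y → L x → L y → f x (_·_ F a y) ≡ a * f x y
      f-·ʳ = proj₁ (proj₂ (proj₂ (proj₂ f-skew)))

      f-antisym : ∀ x y → L x → L y → f x y ≡ - f y x
      f-antisym = proj₁ (proj₂ (proj₂ (proj₂ (proj₂ f-skew))))

      f-nonzero : ∃[ x ] ∃[ y ] (L x × L y × f x y ≢ 0#)
      f-nonzero = proj₂ (proj₂ (proj₂ (proj₂ (proj₂ f-skew))))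

      ·-closed : ∀ {y} → L y → ∀ a → L (_·_ F a y)
      ·-closed {y} Ly a = subst L (sym (·-lin a y y)) (lin-closed L-2 Ly Ly a 0#)

    f-linʳ : ∀ {w y z} → L w → L y → L z → ∀ a b → f w (lin a b y z) ≡ a * f w y + b * f w z
    f-linʳ {w} {y} {z} Lw Ly Lz a b = begin
      f w (lin a b y z)                      ≡⟨ cong (f w) (⊕-·-lin a b y z) ⟨
      f w (_⊕_ F (_·_ F a y) (_·_ F b z))    ≡⟨ f-+ʳ w _ _ Lw (·-closed Ly a) (·-closed Lz b) ⟩
      f w (_·_ F a y) + f w (_·_ F b z)      ≡⟨ cong₂ _+_ (f-·ʳ a w y Lw Ly) (f-·ʳ b w z Lw Lz) ⟩
      a * f w y + b * f w z                  ∎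

    f-linˡ : ∀ {w y z} → L w → L y → L z → ∀ a b → f (lin a b y z) w ≡ a * f y w + b * f z w
    f-linˡ {w} {y} {z} Lw Ly Lz a b = begin
      f (lin a b y z) w                      ≡⟨ cong (λ x → f x w) (⊕-·-lin a b y z) ⟨
      f (_⊕_ F (_·_ F a y) (_·_ F b z)) w    ≡⟨ f-+ˡ _ _ w (·-closed Ly a) (·-closed Lz b) Lw ⟩
      f (_·_ F a y) w + f (_·_ F b z) w      ≡⟨ cong₂ _+_ (f-·ˡ a y w Ly Lw) (f-·ˡ b z w Lz Lw) ⟩
      a * f y w + b * f z w                  ∎

    -- Skew-symmetry gives alternation only because the characteristic is not 2.
    f-alternating : ∀ {y} → L y → f y y ≡ 0#
    f-alternating {y} Ly = x*y≡0⇒y≡0 2≢0 (begin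
      (1# + 1#) * f y y         ≡⟨ distribʳ (f y y) 1# 1# ⟩
      1# * f y y + 1# * f y y   ≡⟨ cong₂ _+_ (*-identityˡ _) (*-identityˡ _) ⟩
      f y y + f y y             ≡⟨ cong (f y y +_) (f-antisym y y Ly Ly) ⟩
      f y y - f y y             ≡⟨ -‿inverseʳ (f y y) ⟩
      0#                        ∎)

    f-shear : ∀ {u v} → L u → L v → ∀ a b → f u (lin a b u v) ≡ b * f u v
    f-shear {u} {v} Lu Lv a b = begin
      f u (lin a b u v)        ≡⟨ f-linʳ Lu Lu Lv a b ⟩
      a * f u u + b * f u v    ≡⟨ cong (λ x → a * x + b * f u v) (f-alternating Lu) ⟩
      a * 0# + b * f u v       ≡⟨ cong (_+ b * f u v) (zeroʳ a) ⟩
      0# + b * f u v           ≡⟨ +-identityˡ _ ⟩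
      b * f u v                ∎

    f-lin-lin : ∀ {u v} → L u → L v → ∀ α β γ δ
              → f (lin α β u v) (lin γ δ u v) ≡ (α * δ - β * γ) * f u v
    f-lin-lin {u} {v} Lu Lv α β γ δ = begin
      f (lin α β u v) (lin γ δ u v)
        ≡⟨ f-linˡ (lin-closed L-2 Lu Lv γ δ) Lu Lv α β ⟩
      α * f u (lin γ δ u v) + β * f v (lin γ δ u v)
        ≡⟨ cong₂ (λ x y → α * x + β * y) (f-linʳ Lu Lu Lv γ δ) (f-linʳ Lv Lu Lv γ δ) ⟩
      α * (γ * f u u + δ * e) + β * (γ * f v u + δ * f v v)
        ≡⟨ cong₂ (λ x y → α * (γ * x + δ * e) + β * (γ * y + δ * f v v))
                 (f-alternating Lu) (f-antisym v u Lv Lu) ⟩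
      α * (γ * 0# + δ * e) + β * (γ * - e + δ * f v v)
        ≡⟨ cong (λ x → α * (γ * 0# + δ * e) + β * (γ * - e + δ * x)) (f-alternating Lv) ⟩
      α * (γ * 0# + δ * e) + β * (γ * - e + δ * 0#)
        ≡⟨ solve 6 (λ α β γ δ e z → α :* (γ :* z :+ δ :* e) :+ β :* (γ :* :- e :+ δ :* z)
                                    := (α :* δ :- β :* γ) :* e :+ (α :* γ :+ β :* δ) :* z) refl α β γ δ e 0# ⟩
      (α * δ - β * γ) * e + (α * γ + β * δ) * 0#
        ≡⟨ cong ((α * δ - β * γ) * e +_) (zeroʳ _) ⟩
      (α * δ - β * γ) * e + 0#
        ≡⟨ +-identityʳ _ ⟩
      (α * δ - β * γ) * e ∎
      where
      e : Carrier
      e = f u v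

    f-basis≢0 : ∀ {u v} → L u → L v → LinIndep F u v → f u v ≢ 0#
    f-basis≢0 {u} {v} Lu Lv indep fuv≡0 with f-nonzero
    ... | x , y , Lx , Ly , fxy≢0 with spanned-by L-2 Lu Lv indep Lx | spanned-by L-2 Lu Lv indep Ly
    ...   | α , β , refl | γ , δ , refl = fxy≢0 (begin
      f (lin α β u v) (lin γ δ u v)  ≡⟨ f-lin-lin Lu Lv α β γ δ ⟩
      (α * δ - β * γ) * f u v        ≡⟨ cong ((α * δ - β * γ) *_) fuv≡0 ⟩
      (α * δ - β * γ) * 0#           ≡⟨ zeroʳ _ ⟩
      0#                             ∎)

module Generator (F : FiniteField) (N : ℕ) (size≡N+1 : FiniteField.size F ≡ N ℕ.+ 1)
                 (g : FiniteField.Carrier F) (g-generates : IsGenerator F g) where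
  open FiniteField F
  open FieldProperties F
  open ≡-Reasoning

  g^≢0 : ∀ k → g ^ k ≢ 0#
  g^≢0 zero    = 0≢1 ∘ sym
  g^≢0 (suc k) = *-nonZero (proj₁ g-generates) (g^≢0 k)

  g^-% : ∀ D .{{_ : ℕ.NonZero D}} → g ^ D ≡ 1# → ∀ k → g ^ k ≡ g ^ (k % D)
  g^-% D gᴰ≡1 k = begin
    g ^ k                            ≡⟨ cong (g ^_) (m≡m%n+[m/n]*n k D) ⟩
    g ^ (k % D ℕ.+ k / D ℕ.* D)      ≡⟨ ^-+ g (k % D) _ ⟩
    g ^ (k % D) * g ^ (k / D ℕ.* D)  ≡⟨ cong (g ^ (k % D) *_) (x^d≡1⇒x^[q*d]≡1 g D gᴰ≡1 (k / D)) ⟩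
    g ^ (k % D) * 1#                 ≡⟨ *-identityʳ _ ⟩
    g ^ (k % D)                      ∎

  private
    indexing : Carrier ↔ Fin (suc N)
    indexing = subst (λ k → Carrier ↔ Fin k) (trans size≡N+1 (ℕₚ.+-comm N 1)) (↔-sym enumeration)

    index : Carrier → Fin (suc N)
    index = Inverse.to indexing

    index-injective : ∀ {x y} → index x ≡ index y → x ≡ y
    index-injective = Injection.injective (Inverse⇒Injection indexing)

    index-from : ∀ i → index (Inverse.from indexing i) ≡ i
    index-from = Inverse.strictlyInverseˡ indexing

  -- The N nonzero elements are powers of g, so their exponents are distinct modulo any period.
  period≥N : ∀ D → 0 ℕ.< D → g ^ D ≡ 1# → N ℕ.≤ D
  period≥N D@(suc _) _ gᴰ≡1 = Finₚ.injective⇒≤ {f = residue} residue-injective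
    where
    nonzero : Fin N → Carrier
    nonzero i = Inverse.from indexing (Fin.punchIn (index 0#) i)

    nonzero≢0 : ∀ i → nonzero i ≢ 0#
    nonzero≢0 i eq = Finₚ.punchInᵢ≢i (index 0#) i (trans (sym (index-from _)) (cong index eq))

    exponent : Fin N → ℕ
    exponent i = proj₁ (proj₂ g-generates (nonzero i) (nonzero≢0 i))

    residue : Fin N → Fin D
    residue i = Fin.fromℕ< (m%n<n (exponent i) D)

    nonzero≡g^residue : ∀ i → nonzero i ≡ g ^ Fin.toℕ (residue i)
    nonzero≡g^residue i = begin
      nonzero i                ≡⟨ proj₂ (proj₂ g-generates (nonzero i) (nonzero≢0 i)) ⟩
      g ^ exponent i           ≡⟨ g^-% D gᴰ≡1 (exponent i) ⟩
      g ^ (exponent i % D)     ≡⟨ cong (g ^_) (Finₚ.toℕ-fromℕ< (m%n<n (exponent i) D)) ⟨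
      g ^ Fin.toℕ (residue i)  ∎

    residue-injective : ∀ {i j} → residue i ≡ residue j → i ≡ j
    residue-injective {i} {j} eq = Finₚ.punchIn-injective (index 0#) i j (begin
      Fin.punchIn (index 0#) i  ≡⟨ index-from _ ⟨
      index (nonzero i)         ≡⟨ cong index nonzero-i≡nonzero-j ⟩
      index (nonzero j)         ≡⟨ index-from _ ⟩
      Fin.punchIn (index 0#) j  ∎)
      where
      nonzero-i≡nonzero-j : nonzero i ≡ nonzero j
      nonzero-i≡nonzero-j = trans (nonzero≡g^residue i)
        (trans (cong (λ r → g ^ Fin.toℕ r) eq) (sym (nonzero≡g^residue j)))

  g^i≡g^j⇒g^[j∸i]≡1 : ∀ {i j} → i ℕ.≤ j → g ^ i ≡ g ^ j → g ^ (j ∸ i) ≡ 1#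
  g^i≡g^j⇒g^[j∸i]≡1 {i} {j} i≤j eq = sym (*-cancelˡ (g^≢0 i) (begin
    g ^ i * 1#               ≡⟨ *-identityʳ _ ⟩
    g ^ i                    ≡⟨ eq ⟩
    g ^ j                    ≡⟨ cong (g ^_) (ℕₚ.m+[n∸m]≡n i≤j) ⟨
    g ^ (i ℕ.+ (j ∸ i))      ≡⟨ ^-+ g i (j ∸ i) ⟩
    g ^ i * g ^ (j ∸ i)      ∎))

  private
    index0≢index-g^ : ∀ (i : Fin (suc N)) → index 0# ≢ index (g ^ Fin.toℕ i)
    index0≢index-g^ i eq = g^≢0 (Fin.toℕ i) (index-injective (sym eq))

  -- Pigeonhole: two of the N + 1 powers g⁰, …, gᴺ coincide, since none of them is 0.
  g^N≡1 : g ^ N ≡ 1#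
  g^N≡1 with Finₚ.pigeonhole (ℕₚ.n<1+n N) (Fin.punchOut ∘ index0≢index-g^)
  ... | i , j , i<j , eq = subst (λ k → g ^ k ≡ 1#) j∸i≡N g^[j∸i]≡1
    where
    g^[j∸i]≡1 : g ^ (Fin.toℕ j ∸ Fin.toℕ i) ≡ 1#
    g^[j∸i]≡1 = g^i≡g^j⇒g^[j∸i]≡1 (ℕₚ.<⇒≤ i<j)
      (index-injective (Finₚ.punchOut-injective (index0≢index-g^ i) (index0≢index-g^ j) eq))
    j∸i≡N : Fin.toℕ j ∸ Fin.toℕ i ≡ N
    j∸i≡N = ℕₚ.≤-antisym
      (ℕₚ.≤-trans (ℕₚ.m∸n≤m (Fin.toℕ j) (Fin.toℕ i)) (ℕₚ.≤-pred (Finₚ.toℕ<n j)))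
      (period≥N _ (ℕₚ.m<n⇒0<n∸m i<j) g^[j∸i]≡1)

  private
    g^-distinct : ∀ {i j} → i ℕ.< j → j ℕ.< N → g ^ i ≢ g ^ j
    g^-distinct {i} {j} i<j j<N eq = ℕₚ.<⇒≱ (ℕₚ.≤-<-trans (ℕₚ.m∸n≤m j i) j<N)
      (period≥N _ (ℕₚ.m<n⇒0<n∸m i<j) (g^i≡g^j⇒g^[j∸i]≡1 (ℕₚ.<⇒≤ i<j) eq))

  g^-injective : ∀ {i j} → i ℕ.< N → j ℕ.< N → g ^ i ≡ g ^ j → i ≡ j
  g^-injective {i} {j} i<N j<N eq with ℕₚ.<-cmp i j
  ... | tri< i<j _ _ = contradiction eq (g^-distinct i<j j<N)
  ... | tri≈ _ i≡j _ = i≡j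
  ... | tri> _ _ j<i = contradiction (sym eq) (g^-distinct j<i i<N)

  discreteLog : .{{_ : ℕ.NonZero N}} → ∀ x → x ≢ 0# → ∃[ k ] (k ℕ.< N × x ≡ g ^ k)
  discreteLog x x≢0 with proj₂ g-generates x x≢0
  ... | k , x≡g^k = k % N , m%n<n k N , trans x≡g^k (g^-% N g^N≡1 k)

m+j*t<d*t : ∀ {m j t d} → m ℕ.< t → j ℕ.< d → m ℕ.+ j ℕ.* t ℕ.< d ℕ.* t
m+j*t<d*t {j = j} {t} m<t j<d = ℕₚ.≤-trans (ℕₚ.+-monoˡ-< (j ℕ.* t) m<t) (ℕₚ.*-monoˡ-≤ t j<d)

m+j*t-injective : ∀ {m m' j j' t} .{{_ : ℕ.NonZero t}} → m ℕ.< t → m' ℕ.< t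
                → m ℕ.+ j ℕ.* t ≡ m' ℕ.+ j' ℕ.* t → m ≡ m' × j ≡ j'
m+j*t-injective {m} {m'} {j} {j'} {t} m<t m'<t eq = m≡m' , ℕₚ.*-cancelʳ-≡ j j' t j*t≡j'*t
  where
  open ≡-Reasoning
  m≡m' : m ≡ m'
  m≡m' = begin
    m                       ≡⟨ m<n⇒m%n≡m m<t ⟨
    m % t                   ≡⟨ [m+kn]%n≡m%n m j t ⟨
    (m ℕ.+ j ℕ.* t) % t     ≡⟨ cong (_% t) eq ⟩
    (m' ℕ.+ j' ℕ.* t) % t   ≡⟨ [m+kn]%n≡m%n m' j' t ⟩
    m' % t                  ≡⟨ m<n⇒m%n≡m m'<t ⟩
    m'                      ∎
  j*t≡j'*t : j ℕ.* t ≡ j' ℕ.* t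
  j*t≡j'*t = ℕₚ.+-cancelˡ-≡ m _ _ (trans eq (cong (ℕ._+ j' ℕ.* t) (sym m≡m')))

module Partition (F : FiniteField) (t : ℕ) .{{_ : ℕ.NonZero t}} {n : ℕ}
  (size≡6t+1 : FiniteField.size F ≡ 6 ℕ.* t ℕ.+ 1)
  (g : FiniteField.Carrier F) (g-generates : IsGenerator F g)
  (f : (W F n → Set) → W F n → W F n → FiniteField.Carrier F) (f-family : IsFormFamily F f)
  (K : W F n → Set) (K-1 : Is1Subspace F K) (u : W F n) (Ku : K u) (u≢0 : u ≢ zeroV F)
  (c : FiniteField.Carrier F) (c≢0 : c ≢ FiniteField.0# F) where
  open FiniteField F
  open FieldProperties F
  open LinearCombinations F
  open Subspaces F
  open SkewForms F
  open Generator F (6 ℕ.* t) size≡6t+1 g g-generates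
  open ≡-Reasoning

  private
    3t<6t : 3 ℕ.* t ℕ.< 6 ℕ.* t
    3t<6t = ℕₚ.*-monoˡ-< t {3} {6} (ℕ.s<s (ℕ.s<s (ℕ.s<s ℕ.z<s)))

    0<6t : 0 ℕ.< 6 ℕ.* t
    0<6t = ℕₚ.*-monoˡ-< t {0} {6} ℕ.z<s

    g^[3t]≢1 : g ^ (3 ℕ.* t) ≢ 1#
    g^[3t]≢1 g^[3t]≡1 = ℕₚ.>⇒≢ (ℕₚ.*-monoˡ-< t {0} {3} ℕ.z<s) (g^-injective 3t<6t 0<6t g^[3t]≡1)

    3t+3t≡6t : ∀ t → 3 ℕ.* t ℕ.+ 3 ℕ.* t ≡ 6 ℕ.* t
    3t+3t≡6t = solve-∀

  g^[3t]≡-1 : g ^ (3 ℕ.* t) ≡ - 1#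
  g^[3t]≡-1 = x²≡1⇒x≡-1 square≡1 g^[3t]≢1
    where
    square≡1 : g ^ (3 ℕ.* t) * g ^ (3 ℕ.* t) ≡ 1#
    square≡1 = trans (sym (^-+ g (3 ℕ.* t) (3 ℕ.* t))) (trans (cong (g ^_) (3t+3t≡6t t)) g^N≡1)

  1+1≢0 : 1# + 1# ≢ 0#
  1+1≢0 1+1≡0 = g^[3t]≢1 (trans g^[3t]≡-1 (sym (inverseʳ-unique 1# 1# 1+1≡0)))

  ω ω² : Carrier
  ω  = g ^ (2 ℕ.* t)
  ω² = ω * ω

  -- vertex j v = A j · u + B j · v with A j = ζ⁻ʲ and B j = ζʲ for ζ = gᵗ; the vertices
  -- 0, 4, 2 form T(u, v) and the vertices 3, 1, 5 form -T(u, v).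
  A B : Fin 6 → Carrier
  A 0F = 1#
  A 1F = - ω
  A 2F = ω²
  A 3F = - 1#
  A 4F = ω
  A 5F = - ω²
  B 0F = 1#
  B 1F = - ω²
  B 2F = ω
  B 3F = - 1#
  B 4F = ω²
  B 5F = - ω

  vertex : Fin 6 → W F n → W F n
  vertex 0F v = _⊕_ F u v
  vertex 1F v = negV F (_⊕_ F (_·_ F ω u) (_·_ F ω² v))
  vertex 2F v = _⊕_ F (_·_ F ω² u) (_·_ F ω v)
  vertex 3F v = negV F (_⊕_ F u v)
  vertex 4F v = _⊕_ F (_·_ F ω u) (_·_ F ω² v)
  vertex 5F v = negV F (_⊕_ F (_·_ F ω² u) (_·_ F ω v))

  side : Fin 6 → W F n → Triple F n
  side 0F v = T F ω u v
  side 1F v = negT F (T F ω u v)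
  side 2F v = T F ω u v
  side 3F v = negT F (T F ω u v)
  side 4F v = T F ω u v
  side 5F v = negT F (T F ω u v)

  Side : W F n → Triple F n → Set
  Side v S = S ≡ T F ω u v ⊎ S ≡ negT F (T F ω u v)

  side-Side : ∀ j v → Side v (side j v)
  side-Side 0F v = inj₁ refl
  side-Side 1F v = inj₂ refl
  side-Side 2F v = inj₁ refl
  side-Side 3F v = inj₂ refl
  side-Side 4F v = inj₁ refl
  side-Side 5F v = inj₂ refl

  vertex∈side : ∀ j v → _∈T_ F (vertex j v) (side j v)
  vertex∈side 0F v = inj₁ refl
  vertex∈side 1F v = inj₂ (inj₁ refl)
  vertex∈side 2F v = inj₂ (inj₂ refl)
  vertex∈side 3F v = inj₁ refl
  vertex∈side 4F v = inj₂ (inj₁ refl)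
  vertex∈side 5F v = inj₂ (inj₂ refl)

  ∈Side : ∀ {v S x} → Side v S → _∈T_ F x S → ∃[ j ] (S ≡ side j v × x ≡ vertex j v)
  ∈Side (inj₁ refl) (inj₁ x≡)        = 0F , refl , x≡
  ∈Side (inj₁ refl) (inj₂ (inj₁ x≡)) = 4F , refl , x≡
  ∈Side (inj₁ refl) (inj₂ (inj₂ x≡)) = 2F , refl , x≡
  ∈Side (inj₂ refl) (inj₁ x≡)        = 3F , refl , x≡
  ∈Side (inj₂ refl) (inj₂ (inj₁ x≡)) = 1F , refl , x≡
  ∈Side (inj₂ refl) (inj₂ (inj₂ x≡)) = 5F , refl , x≡

  vertex-lin : ∀ j v → vertex j v ≡ lin (A j) (B j) u v
  vertex-lin 0F v = ⊕-lin u v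
  vertex-lin 1F v = trans (cong (negV F) (⊕-·-lin ω ω² u v)) (negV-lin ω ω² u v)
  vertex-lin 2F v = ⊕-·-lin ω² ω u v
  vertex-lin 3F v = trans (cong (negV F) (⊕-lin u v)) (negV-lin 1# 1# u v)
  vertex-lin 4F v = ⊕-·-lin ω ω² u v
  vertex-lin 5F v = trans (cong (negV F) (⊕-·-lin ω² ω u v)) (negV-lin ω² ω u v)

  B≡g^[j*t] : ∀ j → B j ≡ g ^ (Fin.toℕ j ℕ.* t)
  B≡g^[j*t] 0F = refl
  B≡g^[j*t] 1F = sym (begin
    g ^ (1 ℕ.* t)                              ≡⟨ *-identityʳ _ ⟨
    g ^ (1 ℕ.* t) * 1#                         ≡⟨ cong (g ^ (1 ℕ.* t) *_) g^N≡1 ⟨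
    g ^ (1 ℕ.* t) * g ^ (6 ℕ.* t)              ≡⟨ ^-+ g (1 ℕ.* t) (6 ℕ.* t) ⟨
    g ^ (1 ℕ.* t ℕ.+ 6 ℕ.* t)                  ≡⟨ cong (g ^_) (7t≡3t+[2t+2t] t) ⟩
    g ^ (3 ℕ.* t ℕ.+ (2 ℕ.* t ℕ.+ 2 ℕ.* t))    ≡⟨ ^-+ g (3 ℕ.* t) _ ⟩
    g ^ (3 ℕ.* t) * g ^ (2 ℕ.* t ℕ.+ 2 ℕ.* t)  ≡⟨ cong₂ _*_ g^[3t]≡-1 (^-+ g (2 ℕ.* t) (2 ℕ.* t)) ⟩
    - 1# * ω²                                  ≡⟨ -1*x≈-x ω² ⟩
    - ω²                                       ∎)
    where
    7t≡3t+[2t+2t] : ∀ t → 1 ℕ.* t ℕ.+ 6 ℕ.* t ≡ 3 ℕ.* t ℕ.+ (2 ℕ.* t ℕ.+ 2 ℕ.* t)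
    7t≡3t+[2t+2t] = solve-∀
  B≡g^[j*t] 2F = refl
  B≡g^[j*t] 3F = sym g^[3t]≡-1
  B≡g^[j*t] 4F = sym (trans (cong (g ^_) (4t≡2t+2t t)) (^-+ g (2 ℕ.* t) (2 ℕ.* t)))
    where
    4t≡2t+2t : ∀ t → 4 ℕ.* t ≡ 2 ℕ.* t ℕ.+ 2 ℕ.* t
    4t≡2t+2t = solve-∀
  B≡g^[j*t] 5F = sym (begin
    g ^ (5 ℕ.* t)                  ≡⟨ cong (g ^_) (5t≡3t+2t t) ⟩
    g ^ (3 ℕ.* t ℕ.+ 2 ℕ.* t)      ≡⟨ ^-+ g (3 ℕ.* t) (2 ℕ.* t) ⟩
    g ^ (3 ℕ.* t) * ω              ≡⟨ cong (_* ω) g^[3t]≡-1 ⟩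
    - 1# * ω                       ≡⟨ -1*x≈-x ω ⟩
    - ω                            ∎)
    where
    5t≡3t+2t : ∀ t → 5 ℕ.* t ≡ 3 ℕ.* t ℕ.+ 2 ℕ.* t
    5t≡3t+2t = solve-∀

  B≢0 : ∀ j → B j ≢ 0#
  B≢0 j B≡0 = g^≢0 (Fin.toℕ j ℕ.* t) (trans (sym (B≡g^[j*t] j)) B≡0)

  m+j*t<6t : ∀ {m} → m ℕ.< t → ∀ (j : Fin 6) → m ℕ.+ Fin.toℕ j ℕ.* t ℕ.< 6 ℕ.* t
  m+j*t<6t m<t j = m+j*t<d*t m<t (Finₚ.toℕ<n j)

  g^[m+j*t]≡B*g^m : ∀ m j → g ^ (m ℕ.+ Fin.toℕ j ℕ.* t) ≡ B j * g ^ m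
  g^[m+j*t]≡B*g^m m j = begin
    g ^ (m ℕ.+ Fin.toℕ j ℕ.* t)       ≡⟨ ^-+ g m _ ⟩
    g ^ m * g ^ (Fin.toℕ j ℕ.* t)     ≡⟨ cong (g ^ m *_) (B≡g^[j*t] j) ⟨
    g ^ m * B j                       ≡⟨ *-comm _ (B j) ⟩
    B j * g ^ m                       ∎

  base-t-digits : ∀ {k} → k ℕ.< 6 ℕ.* t → ∃[ m ] ∃[ j ] (m ℕ.< t × k ≡ m ℕ.+ Fin.toℕ j ℕ.* t)
  base-t-digits {k} k<6t = k % t , Fin.fromℕ< k/t<6 , m%n<n k t , (begin
    k                                           ≡⟨ m≡m%n+[m/n]*n k t ⟩
    k % t ℕ.+ k / t ℕ.* t                       ≡⟨ cong (λ q → k % t ℕ.+ q ℕ.* t) toℕ-j≡k/t ⟨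
    k % t ℕ.+ Fin.toℕ (Fin.fromℕ< k/t<6) ℕ.* t  ∎)
    where
    k/t<6 : k / t ℕ.< 6
    k/t<6 = m<n*o⇒m/o<n k<6t

    toℕ-j≡k/t : Fin.toℕ (Fin.fromℕ< k/t<6) ≡ k / t
    toℕ-j≡k/t = Finₚ.toℕ-fromℕ< k/t<6

  Member : Triple F n → Set₁
  Member = InP F t g f K u c

  vertices-distinct : ∀ {v} → LinIndep F u v → ∀ j j' → j ≢ j' → vertex j v ≢ vertex j' v
  vertices-distinct {v} indep j j' j≢j' eq = j≢j' (Finₚ.toℕ-injective (ℕₚ.*-cancelʳ-≡ _ _ t
    (g^-injective (m+j*t<6t 0<t j) (m+j*t<6t 0<t j') (trans (sym (B≡g^[j*t] j)) (trans Bj≡Bj' (B≡g^[j*t] j'))))))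
    where
    0<t : 0 ℕ.< t
    0<t = ℕ.>-nonZero⁻¹ t
    Bj≡Bj' : B j ≡ B j'
    Bj≡Bj' = proj₂ (LinIndep-coefficients indep (trans (sym (vertex-lin j v)) (trans eq (vertex-lin j' v))))

  vertex∉K : ∀ {v} → LinIndep F u v → ∀ j → ¬ K (vertex j v)
  vertex∉K {v} indep j K∋vertex with Is1Subspace⇒multiple K-1 Ku u≢0 K∋vertex
  ... | a , vertex≡au = B≢0 j (proj₂ (LinIndep-coefficients indep (begin
    lin (A j) (B j) u v  ≡⟨ vertex-lin j v ⟨
    vertex j v           ≡⟨ vertex≡au ⟩
    _·_ F a u            ≡⟨ ·-lin a u v ⟩
    lin a 0# u v         ∎)))

  members-valid : ∀ S → Member S → let (x , y , z) = S in
                  x ≢ y × y ≢ z × x ≢ z × ¬ K x × ¬ K y × ¬ K z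
  members-valid _ (_ , _ , _ , v , _ , indep , _ , inj₁ refl) =
    vertices-distinct indep 0F 4F (λ ()) , vertices-distinct indep 4F 2F (λ ()) ,
    vertices-distinct indep 0F 2F (λ ()) , vertex∉K indep 0F , vertex∉K indep 4F , vertex∉K indep 2F
  members-valid _ (_ , _ , _ , v , _ , indep , _ , inj₂ refl) =
    vertices-distinct indep 3F 1F (λ ()) , vertices-distinct indep 1F 5F (λ ()) ,
    vertices-distinct indep 3F 5F (λ ()) , vertex∉K indep 3F , vertex∉K indep 1F , vertex∉K indep 5F

  form-at-vertex : ∀ {L} → Is2Subspace F L → L u → ∀ {v} → L v → ∀ j
                 → f L u (vertex j v) ≡ B j * f L u v
  form-at-vertex {L} L-2 Lu {v} Lv j =
    trans (cong (f L u) (vertex-lin j v)) (f-shear L-2 (proj₁ f-family L L-2) 1+1≢0 Lu Lv (A j) (B j))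

  -- f only depends on the plane, and a plane is determined by two independent vectors in it.
  forms-agree : ∀ {L L' x} → Is2Subspace F L → Is2Subspace F L' → L u → L x → L' u → L' x
              → LinIndep F u x → f L u x ≡ f L' u x
  forms-agree L-2 L'-2 Lu Lx L'u L'x indep = proj₂ f-family _ _ L-2
    (λ _ → Is2Subspace-⊆ L-2 L'-2 Lu Lx L'u L'x indep , Is2Subspace-⊆ L'-2 L-2 L'u L'x Lu Lx indep)
    u _ Lu Lx

  member-vertex : ∀ {S x} → Member S → _∈T_ F x S
                → ∃[ j ] ∃[ v ] ∃[ m ] (m ℕ.< t × S ≡ side j v × x ≡ vertex j v × LinIndep F u x
                    × (∀ {L'} → Is2Subspace F L' → L' u → L' x
                              → f L' u x ≡ g ^ (m ℕ.+ Fin.toℕ j ℕ.* t) * c))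
  member-vertex {x = x} (L , L-2 , K⊆L , v , Lv , indep , (m , m<t , fLuv≡) , S-side) x∈S
    with ∈Side S-side x∈S
  ... | j , S≡ , refl = j , v , m , m<t , S≡ , refl , indep-ux , form
    where
    Lu : L u
    Lu = K⊆L u Ku
    indep-ux : LinIndep F u (vertex j v)
    indep-ux = subst (LinIndep F u) (sym (vertex-lin j v)) (LinIndep-shear indep (A j) (B≢0 j))
    Lx : L (vertex j v)
    Lx = subst L (sym (vertex-lin j v)) (lin-closed L-2 Lu Lv (A j) (B j))
    form : ∀ {L'} → Is2Subspace F L' → L' u → L' (vertex j v)
         → f L' u (vertex j v) ≡ g ^ (m ℕ.+ Fin.toℕ j ℕ.* t) * c
    form L'-2 L'u L'x = begin
      f _ u (vertex j v)                ≡⟨ forms-agree L'-2 L-2 L'u L'x Lu Lx indep-ux ⟩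
      f L u (vertex j v)                ≡⟨ form-at-vertex L-2 Lu Lv j ⟩
      B j * f L u v                     ≡⟨ cong (B j *_) fLuv≡ ⟩
      B j * (g ^ m * c)                 ≡⟨ *-assoc (B j) (g ^ m) c ⟨
      B j * g ^ m * c                   ≡⟨ cong (_* c) (g^[m+j*t]≡B*g^m m j) ⟨
      g ^ (m ℕ.+ Fin.toℕ j ℕ.* t) * c   ∎

  exponent-injective : ∀ {m m' j j'} → m ℕ.< t → m' ℕ.< t
                     → g ^ (m ℕ.+ Fin.toℕ j ℕ.* t) * c ≡ g ^ (m' ℕ.+ Fin.toℕ j' ℕ.* t) * c → j ≡ j'
  exponent-injective {j = j} {j'} m<t m'<t eq = Finₚ.toℕ-injective (proj₂ (m+j*t-injective m<t m'<t
    (g^-injective (m+j*t<6t m<t j) (m+j*t<6t m'<t j') (*-cancelʳ c≢0 eq))))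

  side-determined : ∀ {j j' v v'} → j ≡ j' → vertex j v ≡ vertex j' v' → side j v ≡ side j' v'
  side-determined {j} {v = v} {v'} refl eq = cong (side j)
    (lin-cancelʳ (A j) u (B≢0 j) (trans (sym (vertex-lin j v)) (trans eq (vertex-lin j v'))))

  members-unique : ∀ S S' x → Member S → Member S' → _∈T_ F x S → _∈T_ F x S' → S ≡ S'
  members-unique S S' x S∈ S'∈ x∈S x∈S' with member-vertex S∈ x∈S | member-vertex S'∈ x∈S'
  ... | j , v , m , m<t , refl , refl , indep , form | j' , v' , m' , m'<t , refl , x≡ , _ , form' =
    side-determined (exponent-injective m<t m'<t same-form-value) x≡
    where
    L-2 : Is2Subspace F (Span u (vertex j v))
    L-2 = Span-is2Subspace indep

    same-form-value : g ^ (m ℕ.+ Fin.toℕ j ℕ.* t) * c ≡ g ^ (m' ℕ.+ Fin.toℕ j' ℕ.* t) * c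
    same-form-value = trans (sym (form L-2 Span∋ˡ Span∋ʳ)) (form' L-2 Span∋ˡ Span∋ʳ)

  form-exponent : ∀ {x} → LinIndep F u x
                → ∃[ m ] ∃[ j ] (m ℕ.< t × f (Span u x) u x ≡ B j * (g ^ m * c))
  form-exponent {x} indep =
    exponent (discreteLog {{ℕₚ.m*n≢0 6 t}} (e * c⁻¹) (*-nonZero e≢0 (inv-nonZero c c≢0)))
    where
    e c⁻¹ : Carrier
    e = f (Span u x) u x
    c⁻¹ = inv c c≢0

    e≢0 : e ≢ 0#
    e≢0 = f-basis≢0 L-2 (proj₁ f-family _ L-2) 1+1≢0 Span∋ˡ Span∋ʳ indep
      where
      L-2 : Is2Subspace F (Span u x)
      L-2 = Span-is2Subspace indep

    exponent : ∃[ k ] (k ℕ.< 6 ℕ.* t × e * c⁻¹ ≡ g ^ k)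
             → ∃[ m ] ∃[ j ] (m ℕ.< t × e ≡ B j * (g ^ m * c))
    exponent (k , k<6t , ec⁻¹≡g^k) with base-t-digits k<6t
    ... | m , j , m<t , k≡m+j*t = m , j , m<t , (begin
      e                                ≡⟨ *-identityʳ e ⟨
      e * 1#                           ≡⟨ cong (e *_) (*-inverseˡ c c≢0) ⟨
      e * (c⁻¹ * c)                    ≡⟨ *-assoc e c⁻¹ c ⟨
      e * c⁻¹ * c                      ≡⟨ cong (_* c) (trans ec⁻¹≡g^k (cong (g ^_) k≡m+j*t)) ⟩
      g ^ (m ℕ.+ Fin.toℕ j ℕ.* t) * c  ≡⟨ cong (_* c) (g^[m+j*t]≡B*g^m m j) ⟩
      B j * g ^ m * c                  ≡⟨ *-assoc (B j) (g ^ m) c ⟩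
      B j * (g ^ m * c)                ∎)

  covers : ∀ x → ¬ K x → ∃[ S ] (Member S × _∈T_ F x S)
  covers x x∉K = cover (form-exponent indep)
    where
    indep : LinIndep F u x
    indep = nonMultiple⇒LinIndep u≢0 λ a x≡au →
      x∉K (subst K (sym x≡au) (Is1Subspace-∋-multiple K-1 Ku u≢0 a))

    L : W F n → Set
    L = Span u x

    L-2 : Is2Subspace F L
    L-2 = Span-is2Subspace indep

    K⊆L : ∀ y → K y → L y
    K⊆L y Ky with Is1Subspace⇒multiple K-1 Ku u≢0 Ky
    ... | a , y≡au = a , 0# , trans y≡au (trans (·-lin a u x) (sym (⊕-·-lin a 0# u x)))

    cover : ∃[ m ] ∃[ j ] (m ℕ.< t × f L u x ≡ B j * (g ^ m * c)) → ∃[ S ] (Member S × _∈T_ F x S)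
    cover (m , j , m<t , fux≡) =
      side j v ,
      (L , L-2 , K⊆L , v , Lv , LinIndep-shear indep _ B⁻¹≢0 , (m , m<t , fuv≡) , side-Side j v) ,
      subst (λ y → _∈T_ F y (side j v)) vertex≡x (vertex∈side j v)
      where
      B⁻¹ : Carrier
      B⁻¹ = inv (B j) (B≢0 j)

      B⁻¹≢0 : B⁻¹ ≢ 0#
      B⁻¹≢0 = inv-nonZero (B j) (B≢0 j)

      v : W F n
      v = lin (- (A j * B⁻¹)) B⁻¹ u x

      Lv : L v
      Lv = _ , _ , sym (⊕-·-lin _ _ u x)

      vertex≡x : vertex j v ≡ x
      vertex≡x = trans (vertex-lin j v) (lin-shear-inverseʳ (A j) (B≢0 j) u x)

      fuv≡ : f L u v ≡ g ^ m * c
      fuv≡ = begin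
        f L u v                     ≡⟨ f-shear L-2 (proj₁ f-family L L-2) 1+1≢0 Span∋ˡ Span∋ʳ _ B⁻¹ ⟩
        B⁻¹ * f L u x               ≡⟨ cong (B⁻¹ *_) fux≡ ⟩
        B⁻¹ * (B j * (g ^ m * c))   ≡⟨ inv-*-cancel (B j) (B≢0 j) (g ^ m * c) ⟩
        g ^ m * c                   ∎

  partition : PartitionsComplement F Member K
  partition = members-valid , covers , λ S S' x S∈ S'∈ x∈S x∈S' y →
    let S≡S' = members-unique S S' x S∈ S'∈ x∈S x∈S'
    in  subst (_∈T_ F y) S≡S' , subst (_∈T_ F y) (sym S≡S')

open import Data.Nat using (_+_; _*_; _≥_)

corollary3 : (F : FiniteField) (t n : ℕ) → FiniteField.size F ≡ 6 * t + 1 → n ≥ 2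
    → (g : FiniteField.Carrier F) → IsGenerator F g
    → (f : (W F n → Set) → W F n → W F n → FiniteField.Carrier F) → IsFormFamily F f
    → (K : W F n → Set) → Is1Subspace F K
    → (u : W F n) → K u → u ≢ zeroV F
    → (c : FiniteField.Carrier F) → c ≢ FiniteField.0# F
    → PartitionsComplement F (InP F t g f K u c) K
corollary3 F zero    _ size≡1    _ _ _ _ _ _ _ _ _ _ _ _ = contradiction size≡1 (FieldProperties.size≢1 F)
corollary3 F (suc t) _ size≡6t+1 _ g g-generates f f-family K K-1 u Ku u≢0 c c≢0 =
  Partition.partition F (suc t) size≡6t+1 g g-generates f f-family K K-1 u Ku u≢0 c c≢0
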